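{- If $G$ is a finite group, then the problems $\mathrm{Member}(G)$, $\mathrm{StrictPrefix}(G)$ and $\mathrm{StrictSuffix}(G)$ are in $\mathrm{UDynProp}$.
   Context: Dynamic descriptive complexity over alphabet $G$: a word $w_1\cdots w_n$ ($w_i\in G$, with $\epsilon$ identified with the identity) is encoded on domain $\{1,\dots,n\}$ with unary relations $W_g$ ($g\in G$) and the order $\le$; changes $\mathrm{set}_g(i)$ set position $i$ to $g$. A dynamic program has, for each auxiliary relation $R$ and each $g$, an update formula $\varphi^R_g(\bar x;y)$; after $\mathrm{set}_g(i)$, new $R=\{\bar a:\varphi^R_g(\bar a;i)$ holds in (changed word, old auxiliary relations)$\}$; initially the word is all identity and auxiliary relations are first-order definable. $\mathrm{Member}(G)$: maintain for each $x\in G$ a $0$-ary relation true iff $w_1\cdots w_n=x$. $\mathrm{StrictPrefix}(G)$ (resp. $\mathrm{StrictSuffix}(G)$): maintain for each $x\in G$ a unary relation containing exactly the positions $i$ with $w_1\cdots w_{i-1}=x$ (resp. $w_{i+1}\cdots w_n=x$). $\mathrm{UDynProp}$: maintainable with auxiliary relations of arity $\le1$ and quantifier-free update formulas. -}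

module Defs where

open import Level using (0ℓ)
open import Algebra.Bundles using (Group)
open import Data.Nat using (ℕ; zero; suc)
open import Data.Fin using (Fin; zero; suc; _≟_) renaming (_≤_ to _≤ᶠ_)
open import Data.Fin.Patterns using (0F; 1F)
open import Data.List using (List; []; _∷_)
open import Data.Product using (Σ; _×_; _,_)
open import Data.Sum using (_⊎_)
open import Data.Unit using (⊤)
open import Data.Empty using (⊥)
open import Relation.Nullary using (¬_; yes; no)
open import Function.Bundles using (Inverse; _⇔_)
import Relation.Binary.PropositionalEquality as ≡

FiniteGroup : Group 0ℓ 0ℓ → Set
FiniteGroup G = Σ ℕ λ k → Inverse (Group.setoid G) (≡.setoid (Fin k))

module _ (G : Group 0ℓ 0ℓ) where
  open Group G renaming (Carrier to C)

  -- Words w₁⋯wₙ over G are functions Fin n → C (positions 1..n are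
  -- 0..n-1 in Fin n).

  Word : ℕ → Set
  Word n = Fin n → C

  prod : ∀ {n} → Word n → C
  prod {zero}  w = ε
  prod {suc n} w = w zero ∙ prod (λ j → w (suc j))

  strictPrefix : ∀ {n} → Word n → Fin n → C
  strictPrefix w zero    = ε
  strictPrefix w (suc i) = w zero ∙ strictPrefix (λ j → w (suc j)) i

  strictSuffix : ∀ {n} → Word n → Fin n → C
  strictSuffix w zero    = prod (λ j → w (suc j))
  strictSuffix w (suc i) = strictSuffix (λ j → w (suc j)) i

  setAt : ∀ {n} → Word n → C → Fin n → Word n
  setAt w g i j with j ≟ i
  ... | yes _ = g
  ... | no  _ = w j

  data FO (v : ℕ) : Set where
    letter : C → Fin v → FO v
    leq    : Fin v → Fin v → FO v
    eq     : Fin v → Fin v → FO v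
    neg    : FO v → FO v
    and    : FO v → FO v → FO v
    ex     : FO (suc v) → FO v            -- ∃ (binds variable 0)

  data QF (m p v : ℕ) : Set where
    tt     : QF m p v
    letter : C → Fin v → QF m p v
    leq    : Fin v → Fin v → QF m p v
    eq     : Fin v → Fin v → QF m p v
    un     : Fin m → Fin v → QF m p v
    nul    : Fin p → QF m p v
    neg    : QF m p v → QF m p v
    and    : QF m p v → QF m p v → QF m p v

  ext : ∀ {n v} → Fin n → (Fin v → Fin n) → Fin (suc v) → Fin n
  ext a ρ zero    = a
  ext a ρ (suc j) = ρ j

  ⟦_⟧FO : ∀ {n v} → FO v → Word n → (Fin v → Fin n) → Set
  ⟦ letter g x ⟧FO w ρ = w (ρ x) ≈ g
  ⟦ leq x y    ⟧FO w ρ = ρ x ≤ᶠ ρ y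
  ⟦ eq x y     ⟧FO w ρ = ρ x ≡.≡ ρ y
  ⟦ neg φ      ⟧FO w ρ = ¬ ⟦ φ ⟧FO w ρ
  ⟦ and φ ψ    ⟧FO w ρ = ⟦ φ ⟧FO w ρ × ⟦ ψ ⟧FO w ρ
  ⟦ ex φ       ⟧FO w ρ = Σ _ λ a → ⟦ φ ⟧FO w (ext a ρ)

  record State (m p n : ℕ) : Set₁ where
    constructor state
    field
      word : Word n
      U    : Fin m → Fin n → Set
      N    : Fin p → Set

  ⟦_⟧QF : ∀ {m p n v} → QF m p v → State m p n → (Fin v → Fin n) → Set
  ⟦ tt         ⟧QF S ρ = ⊤
  ⟦ letter g x ⟧QF S ρ = State.word S (ρ x) ≈ g
  ⟦ leq x y    ⟧QF S ρ = ρ x ≤ᶠ ρ y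
  ⟦ eq x y     ⟧QF S ρ = ρ x ≡.≡ ρ y
  ⟦ un R x     ⟧QF S ρ = State.U S R (ρ x)
  ⟦ nul R      ⟧QF S ρ = State.N S R
  ⟦ neg φ      ⟧QF S ρ = ¬ ⟦ φ ⟧QF S ρ
  ⟦ and φ ψ    ⟧QF S ρ = ⟦ φ ⟧QF S ρ × ⟦ ψ ⟧QF S ρ

  -- Update formulas: for unary R, φ^R_g(x; y) has variables 0 = x, 1 = y;
  -- for nullary R, φ^R_g(; y) has variable 0 = y.

  record UProgram : Set where
    field
      m p   : ℕ
      initU : Fin m → FO 1
      initN : Fin p → FO 0
      updU  : C → Fin m → QF m p 2
      updN  : C → Fin p → QF m p 1

  module _ (P : UProgram) where
    open UProgram P

    initState : ∀ {n} → State m p n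
    initState {n} = state (λ _ → ε)
                      (λ R a → ⟦ initU R ⟧FO (λ _ → ε) (λ _ → a))
                      (λ R → ⟦ initN R ⟧FO (λ (_ : Fin n) → ε) (λ ()))

    -- apply set_g(i): formulas are evaluated on the changed word and the
    -- old auxiliary relations
    step : ∀ {n} → State m p n → C × Fin n → State m p n
    step S (g , i) =
      let S' = state (setAt (State.word S) g i) (State.U S) (State.N S) in
      state (State.word S')
            (λ R a → ⟦ updU g R ⟧QF S' (λ { 0F → a ; 1F → i }))
            (λ R → ⟦ updN g R ⟧QF S' (λ _ → i))

    runFrom : ∀ {n} → State m p n → List (C × Fin n) → State m p n
    runFrom S []       = S
    runFrom S (c ∷ cs) = runFrom (step S c) cs

    run : ∀ {n} → List (C × Fin n) → State m p n
    run = runFrom initState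

  NullaryQuery : Set₁
  NullaryQuery = ∀ {n} → Word n → C → Set

  UnaryQuery : Set₁
  UnaryQuery = ∀ {n} → Word n → C → Fin n → Set

  -- P maintains Q: some nullary aux relation q x always equals the query
  -- for x, for every domain size n ≥ 1 and every sequence of changes.
  MaintainsNullary : NullaryQuery → UProgram → Set
  MaintainsNullary Q P =
    Σ (C → Fin (UProgram.p P)) λ q →
      ∀ n (cs : List (C × Fin (suc n))) (x : C) →
        State.N (run P cs) (q x) ⇔ Q (State.word (run P cs)) x

  MaintainsUnary : UnaryQuery → UProgram → Set
  MaintainsUnary Q P =
    Σ (C → Fin (UProgram.m P)) λ q →
      ∀ n (cs : List (C × Fin (suc n))) (x : C) (i : Fin (suc n)) →
        State.U (run P cs) (q x) i ⇔ Q (State.word (run P cs)) x i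

  UDynPropNullary : NullaryQuery → Set
  UDynPropNullary Q = Σ UProgram (MaintainsNullary Q)

  UDynPropUnary : UnaryQuery → Set
  UDynPropUnary Q = Σ UProgram (MaintainsUnary Q)

  Member : NullaryQuery
  Member w x = prod w ≈ x

  StrictPrefix : UnaryQuery
  StrictPrefix w x i = strictPrefix w i ≈ x

  StrictSuffix : UnaryQuery
  StrictSuffix w x i = strictSuffix w i ≈ x

-- Keep, for every position x and every group element t, whether the letter, the strict
-- prefix product and the strict suffix product at x equal t, and, for every t, whether the
-- whole product equals t. After set_g(i), prefixes at x ≤ i and suffixes at x ≥ i do not
-- change. For x > i the strict prefix at x changes from (p h) r to (p g) r, where p is the
-- strict prefix and h the old letter at i; so it is t iff it used to be (p h)(p g)⁻¹ t.
-- Symmetrically for suffixes at x < i and for the product. As G is finite, the update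
-- formula can read off p and h from the old relations at i by a finite conjunction over all
-- candidate values, so no quantifier is needed.
module Submission where

open import Level using (0ℓ)
open import Algebra.Bundles using (Group)
open import Data.Nat using (ℕ; zero; suc; s≤s; _*_)
open import Data.Nat.Properties using (≰⇒>)
open import Data.Fin using (Fin; zero; suc; _≤_; _<_; _≟_; combine; remQuot)
open import Data.Fin.Patterns using (0F; 1F)
open import Data.Fin.Properties using (_≤?_; ≤-refl; suc-injective; remQuot-combine)
open import Data.Vec.Functional using (tail)
open import Data.Vec.Functional.Relation.Binary.Pointwise using (Pointwise)
open import Data.Product using (Σ; _×_; _,_; proj₁; proj₂)
open import Data.List using ([]; _∷_)
open import Function using (_∘_)
open import Function.Bundles using (Inverse; _⇔_; mk⇔; Equivalence)
import Function.Properties.Equivalence as ⇔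
open import Relation.Binary.PropositionalEquality as ≡ using (_≡_; _≢_)
open import Relation.Nullary using (¬_; Dec; yes; no; Stable; contradiction)
open import Relation.Nullary.Decidable using (map′; decidable-stable)

open import Defs

stable-⇔ : {A B : Set} → A ⇔ B → Stable B → Stable A
stable-⇔ A⇔B stableB ¬¬a =
  Equivalence.from A⇔B (stableB λ ¬b → ¬¬a (¬b ∘ Equivalence.to A⇔B))

module WordAlgebra (G : Group 0ℓ 0ℓ) where
  open Group G renaming (Carrier to C)
  open import Algebra.Properties.Group G
    using (y≈x\\z; x≈z//y; ∙-cancelˡ; ∙-cancelʳ; \\-leftDividesˡ; //-rightDividesˡ; \\-cong₂; //-cong₂)

  ≈-congʳ-⇔ : ∀ {x y z} → y ≈ z → (x ≈ y ⇔ x ≈ z)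
  ≈-congʳ-⇔ y≈z = mk⇔ (λ x≈y → trans x≈y y≈z) (λ x≈z → trans x≈z (sym y≈z))

  ≈-congˡ-⇔ : ∀ {x y z} → x ≈ y → (x ≈ z ⇔ y ≈ z)
  ≈-congˡ-⇔ x≈y = mk⇔ (trans (sym x≈y)) (trans x≈y)

  -- Replacing h by g inside a product: the new product is t iff the old one is oldPrefix/oldSuffix.
  oldPrefix oldSuffix : C → C → C → C → C
  oldPrefix p h g t = (p ∙ h) ∙ ((p ∙ g) \\ t)
  oldSuffix s h g t = (t // (g ∙ s)) ∙ (h ∙ s)

  oldPrefix-cong : ∀ {p p' h h' g g' t} → p ≈ p' → h ≈ h' → g ≈ g' →
                   oldPrefix p h g t ≈ oldPrefix p' h' g' t
  oldPrefix-cong p≈ h≈ g≈ = ∙-cong (∙-cong p≈ h≈) (\\-cong₂ (∙-cong p≈ g≈) refl)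

  oldSuffix-cong : ∀ {s s' h h' g g' t} → s ≈ s' → h ≈ h' → g ≈ g' →
                   oldSuffix s h g t ≈ oldSuffix s' h' g' t
  oldSuffix-cong s≈ h≈ g≈ = ∙-cong (//-cong₂ refl (∙-cong g≈ s≈)) (∙-cong h≈ s≈)

  oldPrefix-⇔ : ∀ {old new p h g r t} → old ≈ (p ∙ h) ∙ r → new ≈ (p ∙ g) ∙ r →
                new ≈ t ⇔ old ≈ oldPrefix p h g t
  oldPrefix-⇔ {p = p} {h} {g} {r} {t} old≈ new≈ = mk⇔
    (λ new≈t → trans old≈ (∙-congˡ (y≈x\\z (p ∙ g) r t (trans (sym new≈) new≈t))))
    (λ old≈t' → trans new≈ (trans
      (∙-congˡ (∙-cancelˡ (p ∙ h) r ((p ∙ g) \\ t) (trans (sym old≈) old≈t')))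
      (\\-leftDividesˡ (p ∙ g) t)))

  oldSuffix-⇔ : ∀ {old new s h g r t} → old ≈ r ∙ (h ∙ s) → new ≈ r ∙ (g ∙ s) →
                new ≈ t ⇔ old ≈ oldSuffix s h g t
  oldSuffix-⇔ {s = s} {h} {g} {r} {t} old≈ new≈ = mk⇔
    (λ new≈t → trans old≈ (∙-congʳ (x≈z//y r (g ∙ s) t (trans (sym new≈) new≈t))))
    (λ old≈t' → trans new≈ (trans
      (∙-congʳ (∙-cancelʳ (h ∙ s) r (t // (g ∙ s)) (trans (sym old≈) old≈t')))
      (//-rightDividesˡ (g ∙ s) t)))

  prod-cong : ∀ {n} {w v : Word G n} → Pointwise _≈_ w v → prod G w ≈ prod G v
  prod-cong {zero}  w≋v = refl
  prod-cong {suc n} w≋v = ∙-cong (w≋v zero) (prod-cong (w≋v ∘ suc))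

  strictPrefix-cong : ∀ {n} {w v : Word G n} → Pointwise _≈_ w v →
                      ∀ a → strictPrefix G w a ≈ strictPrefix G v a
  strictPrefix-cong w≋v zero    = refl
  strictPrefix-cong w≋v (suc a) = ∙-cong (w≋v zero) (strictPrefix-cong (w≋v ∘ suc) a)

  strictSuffix-cong : ∀ {n} {w v : Word G n} → Pointwise _≈_ w v →
                      ∀ a → strictSuffix G w a ≈ strictSuffix G v a
  strictSuffix-cong w≋v zero    = prod-cong (w≋v ∘ suc)
  strictSuffix-cong w≋v (suc a) = strictSuffix-cong (w≋v ∘ suc) a

  prod-split : ∀ {n} (w : Word G n) i →
               prod G w ≈ strictPrefix G w i ∙ (w i ∙ strictSuffix G w i)
  prod-split w zero    = sym (identityˡ _)
  prod-split w (suc i) = trans (∙-congˡ (prod-split (tail w) i)) (sym (assoc _ _ _))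

  prod-ε : ∀ n → prod G {n} (λ _ → ε) ≈ ε
  prod-ε zero    = refl
  prod-ε (suc n) = trans (identityˡ _) (prod-ε n)

  strictPrefix-ε : ∀ {n} (a : Fin n) → strictPrefix G (λ _ → ε) a ≈ ε
  strictPrefix-ε zero    = refl
  strictPrefix-ε (suc a) = trans (identityˡ _) (strictPrefix-ε a)

  strictSuffix-ε : ∀ {n} (a : Fin n) → strictSuffix G (λ _ → ε) a ≈ ε
  strictSuffix-ε {suc n} zero    = prod-ε n
  strictSuffix-ε         (suc a) = strictSuffix-ε a

  AgreeExcept : ∀ {n} → Fin n → Word G n → Word G n → Set
  AgreeExcept i w w' = ∀ j → j ≢ i → w' j ≈ w j

  agreeExcept-tail : ∀ {n i} {w w' : Word G (suc n)} → AgreeExcept (suc i) w w' →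
                     AgreeExcept i (tail w) (tail w')
  agreeExcept-tail agree j j≢i = agree (suc j) (j≢i ∘ suc-injective)

  agreeExcept-zero : ∀ {n} {w w' : Word G (suc n)} → AgreeExcept zero w w' →
                     Pointwise _≈_ (tail w') (tail w)
  agreeExcept-zero agree j = agree (suc j) λ ()

  setAt-self : ∀ {n} (w : Word G n) g i → setAt G w g i i ≈ g
  setAt-self w g i with i ≟ i
  ... | yes _   = refl
  ... | no  i≢i = contradiction ≡.refl i≢i

  setAt-agreeExcept : ∀ {n} (w : Word G n) g i → AgreeExcept i w (setAt G w g i)
  setAt-agreeExcept w g i j j≢i with j ≟ i
  ... | yes j≡i = contradiction j≡i j≢i
  ... | no  _   = refl

  strictPrefix-unchanged : ∀ {n i} {w w' : Word G n} → AgreeExcept i w w' →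
                           ∀ a → a ≤ i → strictPrefix G w' a ≈ strictPrefix G w a
  strictPrefix-unchanged agree zero _ = refl
  strictPrefix-unchanged {i = suc i} agree (suc a) (s≤s a≤i) =
    ∙-cong (agree zero λ ()) (strictPrefix-unchanged (agreeExcept-tail agree) a a≤i)

  strictSuffix-unchanged : ∀ {n i} {w w' : Word G n} → AgreeExcept i w w' →
                           ∀ a → i ≤ a → strictSuffix G w' a ≈ strictSuffix G w a
  strictSuffix-unchanged {i = zero} agree zero    _ = prod-cong (agreeExcept-zero agree)
  strictSuffix-unchanged {i = zero} agree (suc a) _ = strictSuffix-cong (agreeExcept-zero agree) a
  strictSuffix-unchanged {i = suc i} agree (suc a) (s≤s i≤a) =
    strictSuffix-unchanged (agreeExcept-tail agree) a i≤a

  prod-split-changed : ∀ {n i} {w w' : Word G n} → AgreeExcept i w w' →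
                prod G w  ≈ strictPrefix G w i ∙ (w i  ∙ strictSuffix G w i) ×
                prod G w' ≈ strictPrefix G w i ∙ (w' i ∙ strictSuffix G w i)
  prod-split-changed {i = i} {w} {w'} agree =
    prod-split w i ,
    trans (prod-split w' i)
          (∙-cong (strictPrefix-unchanged agree i ≤-refl)
                  (∙-congˡ (strictSuffix-unchanged agree i ≤-refl)))

  strictPrefix-after : ∀ {n i} {w w' : Word G n} → AgreeExcept i w w' → ∀ a → i < a →
    Σ C λ r → strictPrefix G w  a ≈ (strictPrefix G w i ∙ w i)  ∙ r
            × strictPrefix G w' a ≈ (strictPrefix G w i ∙ w' i) ∙ r
  strictPrefix-after {i = zero} {w} agree (suc a) _ =
    strictPrefix G (tail w) a ,
    sym (∙-congʳ (identityˡ _)) ,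
    trans (∙-congˡ (strictPrefix-cong (agreeExcept-zero agree) a)) (sym (∙-congʳ (identityˡ _)))
  strictPrefix-after {i = suc i} agree (suc a) (s≤s i<a) =
    let r , old≈ , new≈ = strictPrefix-after (agreeExcept-tail agree) a i<a in
    r , trans (∙-congˡ old≈) (regroup _ _ _ r) ,
        trans (∙-cong (agree zero λ ()) new≈) (regroup _ _ _ r)
    where
      regroup : ∀ x y z r → x ∙ ((y ∙ z) ∙ r) ≈ ((x ∙ y) ∙ z) ∙ r
      regroup x y z r = trans (sym (assoc _ _ _)) (∙-congʳ (sym (assoc _ _ _)))

  strictSuffix-before : ∀ {n i} {w w' : Word G n} → AgreeExcept i w w' → ∀ a → a < i →
    Σ C λ r → strictSuffix G w  a ≈ r ∙ (w i  ∙ strictSuffix G w i)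
            × strictSuffix G w' a ≈ r ∙ (w' i ∙ strictSuffix G w i)
  strictSuffix-before {i = suc i} agree zero _ = _ , prod-split-changed (agreeExcept-tail agree)
  strictSuffix-before {i = suc i} agree (suc a) (s≤s a<i) =
    strictSuffix-before (agreeExcept-tail agree) a a<i

module Formulas (G : Group 0ℓ 0ℓ) where

  infix 4 _⊨[_]_
  _⊨[_]_ : ∀ {m p n v} → State G m p n → (Fin v → Fin n) → QF G m p v → Set
  S ⊨[ ρ ] φ = ⟦_⟧QF G φ S ρ

  module _ {m p v : ℕ} where
    infixr 6 _⇒_
    infix 5 if_then_else_

    _⇒_ : QF G m p v → QF G m p v → QF G m p v
    φ ⇒ ψ = neg (and φ (neg ψ))

    ⋀ : ∀ {j} → (Fin j → QF G m p v) → QF G m p v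
    ⋀ {zero}  φ = tt
    ⋀ {suc j} φ = and (φ zero) (⋀ (φ ∘ suc))

    if_then_else_ : QF G m p v → QF G m p v → QF G m p v → QF G m p v
    if c then φ else ψ = and (c ⇒ φ) (neg c ⇒ ψ)

    -- For the unique z satisfying guard, this is φ z.
    cases : ∀ {j} → (guard φ : Fin j → QF G m p v) → QF G m p v
    cases guard φ = ⋀ λ z → guard z ⇒ φ z

    module _ {n} {S : State G m p n} {ρ : Fin v → Fin n} where

      ⋀-elim : ∀ {j} (φ : Fin j → QF G m p v) → S ⊨[ ρ ] ⋀ φ → ∀ z → S ⊨[ ρ ] φ z
      ⋀-elim {suc j} φ (φ₀ , φₛ) zero    = φ₀
      ⋀-elim {suc j} φ (φ₀ , φₛ) (suc z) = ⋀-elim (φ ∘ suc) φₛ z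

      ⋀-intro : ∀ {j} (φ : Fin j → QF G m p v) → (∀ z → S ⊨[ ρ ] φ z) → S ⊨[ ρ ] ⋀ φ
      ⋀-intro {zero}  φ all = _
      ⋀-intro {suc j} φ all = all zero , ⋀-intro (φ ∘ suc) (all ∘ suc)

      cases-⇔ : ∀ {j} {guard φ : Fin j → QF G m p v} {z₀} →
                (∀ z → S ⊨[ ρ ] guard z → z₀ ≡ z) → S ⊨[ ρ ] guard z₀ →
                Stable (S ⊨[ ρ ] φ z₀) → S ⊨[ ρ ] cases guard φ ⇔ S ⊨[ ρ ] φ z₀
      cases-⇔ {guard = guard} {φ} {z₀} unique guard₀ stable = mk⇔
        (λ all → stable λ ¬φ₀ → ⋀-elim (λ z → guard z ⇒ φ z) all z₀ (guard₀ , ¬φ₀))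
        (λ φ₀ → ⋀-intro (λ z → guard z ⇒ φ z) λ z (guardz , ¬φz) →
          ¬φz (≡.subst (λ z → S ⊨[ ρ ] φ z) (unique z guardz) φ₀))

      if-⇔ : ∀ c φ ψ {P : Set} → Dec (S ⊨[ ρ ] c) →
             (S ⊨[ ρ ] c → S ⊨[ ρ ] φ ⇔ P) → (¬ S ⊨[ ρ ] c → S ⊨[ ρ ] ψ ⇔ P) → Stable P →
             S ⊨[ ρ ] if c then φ else ψ ⇔ P
      if-⇔ _ _ _ (yes c) then-⇔ _ stable = mk⇔
        (λ (c⇒φ , _) → stable λ ¬P → c⇒φ (c , ¬P ∘ Equivalence.to (then-⇔ c)))
        (λ P → (λ (_ , ¬φ) → ¬φ (Equivalence.from (then-⇔ c) P)) , (λ (¬c , _) → ¬c c))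
      if-⇔ _ _ _ (no ¬c) _ else-⇔ stable = mk⇔
        (λ (_ , ¬c⇒ψ) → stable λ ¬P → ¬c⇒ψ (¬c , ¬P ∘ Equivalence.to (else-⇔ ¬c)))
        (λ P → (λ (c , _) → ¬c c) , (λ (_ , ¬ψ) → ¬ψ (Equivalence.from (else-⇔ ¬c) P)))

  -- ∀x. x = x, true on every domain, including the empty one.
  truth : ∀ {v} → FO G v
  truth = neg (ex (neg (eq 0F 0F)))

  decided : ∀ {v} {X : Set} → Dec X → FO G v
  decided (yes _) = truth
  decided (no _)  = neg truth

  decided-⇔ : ∀ {n v} {X : Set} (d : Dec X) (w : Word G n) (ρ : Fin v → Fin n) →
              ⟦_⟧FO G (decided d) w ρ ⇔ X
  decided-⇔ (yes x) w ρ = mk⇔ (λ _ → x) (λ _ (_ , a≢a) → a≢a ≡.refl)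
  decided-⇔ (no ¬x) w ρ = mk⇔ (λ ¬truth → contradiction (λ (_ , a≢a) → a≢a ≡.refl) ¬truth)
                              (λ x → contradiction x ¬x)

module Program (G : Group 0ℓ 0ℓ) (k : ℕ) (I : Inverse (Group.setoid G) (≡.setoid (Fin k))) where
  open Group G renaming (Carrier to C)
  open WordAlgebra G
  open Formulas G

  enc : C → Fin k
  enc = Inverse.to I

  dec : Fin k → C
  dec = Inverse.from I

  dec-enc : ∀ x → dec (enc x) ≈ x
  dec-enc x = Inverse.inverseʳ I ≡.refl

  enc-unique : ∀ {x t} → x ≈ dec t → enc x ≡ t
  enc-unique = Inverse.inverseˡ I

  _≈?_ : ∀ x y → Dec (x ≈ y)
  x ≈? y = map′ (λ e → trans (sym (dec-enc x)) (Inverse.inverseʳ I e)) (Inverse.to-cong I)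
                (enc x ≟ enc y)

  ≈-stable : ∀ {x y} → Stable (x ≈ y)
  ≈-stable {x} {y} = decidable-stable (x ≈? y)

  -- The auxiliary unary relations are indexed by a kind and (the code of) a group element:
  -- "the letter / strict prefix / strict suffix at x is t".
  pattern letterᴷ = zero
  pattern prefixᴷ = suc zero
  pattern suffixᴷ = suc (suc zero)

  value : ∀ {n} → Fin 3 → Word G n → Fin n → C
  value letterᴷ w a = w a
  value prefixᴷ w a = strictPrefix G w a
  value suffixᴷ w a = strictSuffix G w a

  Describes : ∀ {n} → Word G n → Fin 3 × Fin k → Fin n → Set
  Describes w (kind , t) a = value kind w a ≈ dec t

  rel : Fin 3 × Fin k → Fin (3 * k)
  rel (kind , t) = combine kind t

  Represents : ∀ {n} → Word G n → (Fin (3 * k) → Fin n → Set) → (Fin k → Set) → Set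
  Represents w U N = (∀ R a → U R a ⇔ Describes w (remQuot {3} k R) a)
                   × (∀ t → N t ⇔ prod G w ≈ dec t)

  atValue : ∀ {v} → Fin 3 → Fin v → (Fin k → QF G (3 * k) k v) → QF G (3 * k) k v
  atValue kind y = cases λ t → un (rel (kind , t)) y

  oldPrefixCode oldSuffixCode : C → Fin k → Fin k → Fin k → Fin k
  oldPrefixCode g t p h = enc (oldPrefix (dec p) (dec h) g (dec t))
  oldSuffixCode g t s h = enc (oldSuffix (dec s) (dec h) g (dec t))

  oldPrefixCode-decoded : ∀ {g g'} t p h → g ≈ g' →
                          dec (oldPrefixCode g t (enc p) (enc h)) ≈ oldPrefix p h g' (dec t)
  oldPrefixCode-decoded t p h g≈g' = trans (dec-enc _) (oldPrefix-cong (dec-enc p) (dec-enc h) g≈g')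

  oldSuffixCode-decoded : ∀ {g g'} t s h → g ≈ g' →
                          dec (oldSuffixCode g t (enc s) (enc h)) ≈ oldSuffix s h g' (dec t)
  oldSuffixCode-decoded t s h g≈g' = trans (dec-enc _) (oldSuffix-cong (dec-enc s) (dec-enc h) g≈g')

  -- Variables of update formulas: 0F is the position x being defined, 1F the changed position.
  prefixShifted suffixShifted : C → Fin k → QF G (3 * k) k 2
  prefixShifted g t = atValue prefixᴷ 1F λ p → atValue letterᴷ 1F λ h →
    un (rel (prefixᴷ , oldPrefixCode g t p h)) 0F
  suffixShifted g t = atValue suffixᴷ 1F λ s → atValue letterᴷ 1F λ h →
    un (rel (suffixᴷ , oldSuffixCode g t s h)) 0F

  update : C → Fin 3 × Fin k → QF G (3 * k) k 2
  update g (letterᴷ , t) = letter (dec t) 0F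
  update g (prefixᴷ , t) = if leq 0F 1F then un (rel (prefixᴷ , t)) 0F else prefixShifted g t
  update g (suffixᴷ , t) = if leq 1F 0F then un (rel (suffixᴷ , t)) 0F else suffixShifted g t

  -- The product is p (h s) with s the strict suffix at the changed position, as for suffixes.
  productUpdate : C → Fin k → QF G (3 * k) k 1
  productUpdate g t =
    atValue suffixᴷ 0F λ s → atValue letterᴷ 0F λ h → nul (oldSuffixCode g t s h)

  program : UProgram G
  program = record
    { m     = 3 * k
    ; p     = k
    ; initU = λ R → decided (ε ≈? dec (proj₂ (remQuot {3} k R)))
    ; initN = λ t → decided (ε ≈? dec t)
    ; updU  = λ g R → update g (remQuot {3} k R)
    ; updN  = productUpdate
    }

  module _ {n} {w : Word G n} {U N} (represents : Represents w U N) where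

    rel-⇔ : ∀ c a → U (rel c) a ⇔ Describes w c a
    rel-⇔ (kind , t) a =
      ≡.subst (λ c → U (combine kind t) a ⇔ Describes w c a) (remQuot-combine kind t)
              (proj₁ represents (combine kind t) a)

    rel-stable : ∀ c a → Stable (U (rel c) a)
    rel-stable c a = stable-⇔ (rel-⇔ c a) ≈-stable

    -- Update formulas see the changed word w' together with the old relations, which describe w.
    module _ {v} (w' : Word G n) {ρ : Fin v → Fin n} where

      atValue-⇔ : ∀ kind y (φ : Fin k → QF G (3 * k) k v) →
                  let z₀ = enc (value kind w (ρ y)) in
                  Stable (state w' U N ⊨[ ρ ] φ z₀) →
                  state w' U N ⊨[ ρ ] atValue kind y φ ⇔ state w' U N ⊨[ ρ ] φ z₀
      atValue-⇔ kind y φ = cases-⇔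
        (λ t u → enc-unique (Equivalence.to (rel-⇔ (kind , t) (ρ y)) u))
        (Equivalence.from (rel-⇔ (kind , _) (ρ y)) (sym (dec-enc _)))

      atValue₂-⇔ : ∀ kind y (φ : Fin k → Fin k → QF G (3 * k) k v) →
                   let z₀ = enc (value kind w (ρ y)) ; h₀ = enc (w (ρ y)) in
                   Stable (state w' U N ⊨[ ρ ] φ z₀ h₀) →
                   state w' U N ⊨[ ρ ] atValue kind y (λ z → atValue letterᴷ y (φ z)) ⇔
                   state w' U N ⊨[ ρ ] φ z₀ h₀
      atValue₂-⇔ kind y φ stable =
        ⇔.trans (atValue-⇔ kind y _ (stable-⇔ inner stable)) inner
        where inner = atValue-⇔ letterᴷ y (φ _) stable

    module _ (g : C) where

      prefixKept-⇔ : ∀ (ρ : Fin 2 → Fin n) t → ρ 0F ≤ ρ 1F → let w' = setAt G w g (ρ 1F) in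
                     state w' U N ⊨[ ρ ] un (rel (prefixᴷ , t)) 0F ⇔ strictPrefix G w' (ρ 0F) ≈ dec t
      prefixKept-⇔ ρ t a≤i = ⇔.trans (rel-⇔ (prefixᴷ , t) (ρ 0F))
        (≈-congˡ-⇔ (sym (strictPrefix-unchanged (setAt-agreeExcept w g (ρ 1F)) (ρ 0F) a≤i)))

      suffixKept-⇔ : ∀ (ρ : Fin 2 → Fin n) t → ρ 1F ≤ ρ 0F → let w' = setAt G w g (ρ 1F) in
                     state w' U N ⊨[ ρ ] un (rel (suffixᴷ , t)) 0F ⇔ strictSuffix G w' (ρ 0F) ≈ dec t
      suffixKept-⇔ ρ t i≤a = ⇔.trans (rel-⇔ (suffixᴷ , t) (ρ 0F))
        (≈-congˡ-⇔ (sym (strictSuffix-unchanged (setAt-agreeExcept w g (ρ 1F)) (ρ 0F) i≤a)))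

      prefixShifted-⇔ : ∀ (ρ : Fin 2 → Fin n) t → ρ 1F < ρ 0F → let w' = setAt G w g (ρ 1F) in
                        state w' U N ⊨[ ρ ] prefixShifted g t ⇔ strictPrefix G w' (ρ 0F) ≈ dec t
      prefixShifted-⇔ ρ t i<a =
        let _ , old≈ , new≈ = strictPrefix-after (setAt-agreeExcept w g i) (ρ 0F) i<a in
        ⇔.trans (atValue₂-⇔ (setAt G w g i) prefixᴷ 1F _ (rel-stable c (ρ 0F)))
          (⇔.trans (rel-⇔ c (ρ 0F))
          (⇔.trans (≈-congʳ-⇔ (oldPrefixCode-decoded t _ _ (sym (setAt-self w g i))))
                   (⇔.sym (oldPrefix-⇔ old≈ new≈))))
        where
          i = ρ 1F
          c = prefixᴷ , oldPrefixCode g t (enc (strictPrefix G w i)) (enc (w i))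

      suffixShifted-⇔ : ∀ (ρ : Fin 2 → Fin n) t → ρ 0F < ρ 1F → let w' = setAt G w g (ρ 1F) in
                        state w' U N ⊨[ ρ ] suffixShifted g t ⇔ strictSuffix G w' (ρ 0F) ≈ dec t
      suffixShifted-⇔ ρ t a<i =
        let _ , old≈ , new≈ = strictSuffix-before (setAt-agreeExcept w g i) (ρ 0F) a<i in
        ⇔.trans (atValue₂-⇔ (setAt G w g i) suffixᴷ 1F _ (rel-stable c (ρ 0F)))
          (⇔.trans (rel-⇔ c (ρ 0F))
          (⇔.trans (≈-congʳ-⇔ (oldSuffixCode-decoded t _ _ (sym (setAt-self w g i))))
                   (⇔.sym (oldSuffix-⇔ old≈ new≈))))
        where
          i = ρ 1F
          c = suffixᴷ , oldSuffixCode g t (enc (strictSuffix G w i)) (enc (w i))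

      updated : ∀ (ρ : Fin 2 → Fin n) c → let w' = setAt G w g (ρ 1F) in
                state w' U N ⊨[ ρ ] update g c ⇔ Describes w' c (ρ 0F)
      updated ρ (letterᴷ , t) = ⇔.refl
      updated ρ (prefixᴷ , t) =
        if-⇔ (leq 0F 1F) (un (rel (prefixᴷ , t)) 0F) (prefixShifted g t) (ρ 0F ≤? ρ 1F)
             (prefixKept-⇔ ρ t) (prefixShifted-⇔ ρ t ∘ ≰⇒>) ≈-stable
      updated ρ (suffixᴷ , t) =
        if-⇔ (leq 1F 0F) (un (rel (suffixᴷ , t)) 0F) (suffixShifted g t) (ρ 1F ≤? ρ 0F)
             (suffixKept-⇔ ρ t) (suffixShifted-⇔ ρ t ∘ ≰⇒>) ≈-stable

      productUpdated : ∀ (ρ : Fin 1 → Fin n) t → let w' = setAt G w g (ρ 0F) in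
                       state w' U N ⊨[ ρ ] productUpdate g t ⇔ prod G w' ≈ dec t
      productUpdated ρ t =
        let old≈ , new≈ = prod-split-changed (setAt-agreeExcept w g i) in
        ⇔.trans (atValue₂-⇔ (setAt G w g i) suffixᴷ 0F _ (stable-⇔ (proj₂ represents _) ≈-stable))
          (⇔.trans (proj₂ represents _)
          (⇔.trans (≈-congʳ-⇔ (oldSuffixCode-decoded t _ _ (sym (setAt-self w g i))))
                   (⇔.sym (oldSuffix-⇔ old≈ new≈))))
        where i = ρ 0F

  Invariant : ∀ {n} → State G (3 * k) k n → Set
  Invariant S = Represents (State.word S) (State.U S) (State.N S)

  step-invariant : ∀ {n} (S : State G (3 * k) k n) → Invariant S →
                   ∀ c → Invariant (step G program S c)
  step-invariant S invariant (g , i) =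
    (λ R a → updated invariant g _ (remQuot {3} k R)) , productUpdated invariant g _

  value-ε : ∀ {n} kind (a : Fin n) → value kind (λ _ → ε) a ≈ ε
  value-ε letterᴷ a = refl
  value-ε prefixᴷ a = strictPrefix-ε a
  value-ε suffixᴷ a = strictSuffix-ε a

  describes-ε : ∀ {n} c (a : Fin n) → Describes (λ _ → ε) c a ⇔ ε ≈ dec (proj₂ c)
  describes-ε (kind , t) a = ≈-congˡ-⇔ (value-ε kind a)

  init-invariant : ∀ {n} → Invariant (initState G program {n})
  init-invariant {n} =
    (λ R a → ⇔.trans (decided-⇔ (ε ≈? _) (λ _ → ε) (λ _ → a))
                     (⇔.sym (describes-ε (remQuot {3} k R) a))) ,
    (λ t → ⇔.trans (decided-⇔ (ε ≈? dec t) (λ _ → ε) (λ ())) (⇔.sym (≈-congˡ-⇔ (prod-ε n))))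

  runFrom-invariant : ∀ {n} (S : State G (3 * k) k n) → Invariant S →
                      ∀ cs → Invariant (runFrom G program S cs)
  runFrom-invariant S invariant []       = invariant
  runFrom-invariant S invariant (c ∷ cs) =
    runFrom-invariant (step G program S c) (step-invariant S invariant c) cs

  run-invariant : ∀ {n} cs → Invariant (run G program {n} cs)
  run-invariant = runFrom-invariant _ init-invariant

  maintains-product : MaintainsNullary G (λ w x → prod G w ≈ x) program
  maintains-product = enc , λ n cs x →
    ⇔.trans (proj₂ (run-invariant cs) (enc x)) (≈-congʳ-⇔ (dec-enc x))

  maintains-value : ∀ kind → MaintainsUnary G (λ w x a → value kind w a ≈ x) program
  maintains-value kind = (λ x → rel (kind , enc x)) , λ n cs x a →
    ⇔.trans (rel-⇔ (run-invariant cs) (kind , enc x) a) (≈-congʳ-⇔ (dec-enc x))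

mainTheorem8 : (G : Group 0ℓ 0ℓ) → FiniteGroup G →
    UDynPropNullary G (Member G)
      × UDynPropUnary G (StrictPrefix G)
      × UDynPropUnary G (StrictSuffix G)
mainTheorem8 G (k , I) =
  (program , maintains-product) ,
  (program , maintains-value prefixᴷ) ,
  (program , maintains-value suffixᴷ)
  where open Program G k I
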